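{- Let $H$ be a finite simple graph. Then $H$ is realizable if and only if there exists a clique cover $\{\kappa_1,\dots,\kappa_n\}$ of $H$ such that the polynomial system in the variables $(m_{ij})_{i,j\in[n]}$ $$\forall\, W\subseteq[n],\qquad \sum_{\sigma\in\mathrm{Cyc}_W}\ \prod_{v\in W} m_{v,\sigma(v)} \;=\; \big|\mathcal{K}_W\big|,\qquad \mathcal{K}_W:=\bigcap_{v\in W}\kappa_v\setminus\bigcup_{v\in[n]\setminus W}\kappa_v,$$ admits a solution in nonnegative integers. In that case, $H$ is realized by the directed multigraph $G$ with vertex set $[n]$ whose adjacency matrix $\mathbf{A}$ is given by $\mathbf{A}_{i,j}=m_{i,j}$ for $1\le i,j\le n$.
   Context: A directed multigraph $G$ has a finite vertex set and a finite multiset of arcs (loops and multiple arcs allowed); its adjacency matrix $\mathbf{A}$ has $\mathbf{A}_{i,j}$ equal to the number of arcs from $i$ to $j$. A simple cycle of $G$ is a closed sequence of arcs $(i_0,i_1)_{k_1}\cdots(i_{\ell-1},i_0)_{k_\ell}$, $\ell\ge1$, with all $i_t$ distinct, considered up to cyclic rotation (orientation and the specific arcs used matter; a self-loop is a simple cycle of length one). The hike dependency graph $\phi(G)$ is the simple graph whose vertices are the simple cycles of $G$, two distinct simple cycles being adjacent iff they share a vertex of $G$. A finite simple graph $H$ is realizable if $H\cong\phi(G)$ for some directed multigraph $G$, and $G$ then realizes $H$. A clique cover of $H$ is a finite family of cliques (complete subgraphs, identified with their vertex sets) of $H$ such that every vertex and every edge of $H$ lies in at least one of them. For a finite set $S$,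 $\mathrm{Cyc}_S$ denotes the set of permutations of $S$ consisting of a single cycle (cyclic permutations of $S$; for $|S|=1$ this is the identity). For $W=\emptyset$ the equation is the trivial equation $0=0$. -}

module Defs where

open import Data.Nat using (ℕ; zero; suc; _<_)
open import Data.Bool using (Bool; true; false; T; if_then_else_; not; _∨_; _∧_)
import Data.Bool as Bool
open import Data.Fin using (Fin; _≟_)
open import Data.List using (List; []; _∷_; map; filterᵇ; allFin; drop; take; _++_; concatMap; length; upTo)
open import Data.Bool.ListAction using (all; any)
open import Data.Nat.ListAction using (sum; product)
open import Data.List.Relation.Unary.All using (All)
open import Data.List.Relation.Unary.Unique.Propositional using (Unique)
open import Data.List.Membership.Propositional using (_∈_)
open import Data.Vec using (Vec; lookup) renaming ([] to []ᵥ; _∷_ to _∷ᵥ_)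
open import Data.Product using (Σ; ∃; _×_; _,_; proj₁; proj₂)
open import Relation.Nullary using (¬_; ⌊_⌋)
open import Relation.Binary.PropositionalEquality using (_≡_; _≢_)
open import Function.Bundles using (_⇔_)

record SimpleGraph (k : ℕ) : Set₁ where
  field
    Adj    : Fin k → Fin k → Set
    sym    : ∀ {x y} → Adj x y → Adj y x
    irrefl : ∀ {x} → ¬ Adj x x
open SimpleGraph public

-- Directed multigraphs on vertex set Fin n, given by their adjacency
-- matrix A : Fin n → Fin n → ℕ.  An arc (i , j , t) is the t-th arc
-- from i to j (valid iff t < A i j).

Arc : ℕ → Set
Arc n = Fin n × Fin n × ℕ

src : ∀ {n} → Arc n → Fin n
src (i , _ , _) = i

tgt : ∀ {n} → Arc n → Fin n
tgt (_ , j , _) = j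

ValidArc : ∀ {n} → (Fin n → Fin n → ℕ) → Arc n → Set
ValidArc A (i , j , t) = t < A i j

IsSimpleCycle : ∀ {n} → (Fin n → Fin n → ℕ) → List (Arc n) → Set
IsSimpleCycle A l =
  (l ≢ []) ×
  All (ValidArc A) l ×
  (map tgt l ≡ drop 1 (map src l) ++ take 1 (map src l)) ×
  Unique (map src l)

SimpleCycle : ∀ {n} → (Fin n → Fin n → ℕ) → Set
SimpleCycle A = Σ (List (Arc _)) (IsSimpleCycle A)

-- equality of simple cycles: up to cyclic rotation
_≈ᶜ_ : ∀ {n} {A : Fin n → Fin n → ℕ} → SimpleCycle A → SimpleCycle A → Set
c ≈ᶜ c' = ∃ λ r → proj₁ c' ≡ drop r (proj₁ c) ++ take r (proj₁ c)

ShareVertex : ∀ {n} {A : Fin n → Fin n → ℕ} → SimpleCycle A → SimpleCycle A → Set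
ShareVertex c c' = ∃ λ v → (v ∈ map src (proj₁ c)) × (v ∈ map src (proj₁ c'))

-- H ≅ φ(G): a bijection f from the vertices of H onto the simple cycles
-- of G modulo rotation, such that distinct vertices are adjacent in H
-- iff their cycles share a vertex of G.
Realizes : ∀ {n k} → (Fin n → Fin n → ℕ) → SimpleGraph k → Set
Realizes {n} {k} A H =
  Σ (Fin k → SimpleCycle A) λ f →
    (∀ a b → f a ≈ᶜ f b → a ≡ b) ×
    (∀ c → ∃ λ a → f a ≈ᶜ c) ×
    (∀ a b → a ≢ b → (Adj H a b ⇔ ShareVertex (f a) (f b)))

Realizable : ∀ {k} → SimpleGraph k → Set
Realizable H = ∃ λ n → ∃ λ (A : Fin n → Fin n → ℕ) → Realizes A H

IsClique : ∀ {k} → SimpleGraph k → (Fin k → Bool) → Set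
IsClique H κ = ∀ x y → T (κ x) → T (κ y) → x ≢ y → Adj H x y

IsCliqueCover : ∀ {n k} → SimpleGraph k → (Fin n → Fin k → Bool) → Set
IsCliqueCover H κ =
  (∀ v → IsClique H (κ v)) ×
  (∀ x → ∃ λ v → T (κ v x)) ×
  (∀ x y → Adj H x y → ∃ λ v → T (κ v x) × T (κ v y))

-- |K_W| where K_W = ⋂_{v∈W} κ_v \ ⋃_{v∉W} κ_v
--                 = { x | ∀ v, (x ∈ κ_v ⇔ v ∈ W) }
cardK : ∀ {n k} → (Fin n → Fin k → Bool) → (Fin n → Bool) → ℕ
cardK {n} {k} κ W =
  length (filterᵇ (λ x → all (λ v → ⌊ κ v x Bool.≟ W v ⌋) (allFin n)) (allFin k))

-- Cyclic permutations of W ⊆ [n], as maps σ : Fin n → Fin n that fix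
-- every point outside W, map W into W, and such that every point of W
-- is reached from every point of W by iterating σ (single cycle).

iter : ∀ {n} → (Fin n → Fin n) → ℕ → Fin n → Fin n
iter σ zero    x = x
iter σ (suc t) x = σ (iter σ t x)

isCyc : ∀ {n} → (Fin n → Bool) → (Fin n → Fin n) → Bool
isCyc {n} W σ =
  all (λ v → if W v then W (σ v) else ⌊ σ v ≟ v ⌋) (allFin n) ∧
  all (λ w → not (W w) ∨
        all (λ v → not (W v) ∨ any (λ t → ⌊ iter σ t w ≟ v ⌋) (upTo n))
            (allFin n))
      (allFin n)

allVecs : ∀ n m → List (Vec (Fin n) m)
allVecs n zero    = []ᵥ ∷ []
allVecs n (suc m) = concatMap (λ x → map (x ∷ᵥ_) (allVecs n m)) (allFin n)

allMaps : ∀ n → List (Fin n → Fin n)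
allMaps n = map lookup (allVecs n n)

Cyc : ∀ {n} → (Fin n → Bool) → List (Fin n → Fin n)
Cyc {n} W = filterᵇ (isCyc W) (allMaps n)

cycSum : ∀ {n} → (Fin n → Fin n → ℕ) → (Fin n → Bool) → ℕ
cycSum {n} m W =
  sum (map (λ σ → product (map (λ v → m v (σ v)) (filterᵇ W (allFin n)))) (Cyc W))

-- m solves the polynomial system for the cover κ (all nonempty W;
-- the W = ∅ equation is the trivial 0 = 0)
Solves : ∀ {n k} → (Fin n → Fin k → Bool) → (Fin n → Fin n → ℕ) → Set
Solves {n} κ m = ∀ (W : Fin n → Bool) → (∃ λ v → T (W v)) → cycSum m W ≡ cardK κ W

-- A simple cycle of the multigraph with adjacency matrix m is determined, up
-- to rotation, by its vertex set W, the cyclic permutation σ of W that it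
-- follows, and for each v ∈ W the choice of one of the m v (σ v) arcs from v
-- to σ v. Hence for nonempty W there are exactly cycSum m W of them, and
-- writing each from the least vertex of W gives an explicit list of
-- representatives.
--
-- If φ realizes H, put x ∈ κ_v when the cycle φ x passes through v. Cycles
-- sharing v are adjacent, so each κ_v is a clique; every edge is covered
-- since adjacent cycles share a vertex; and K_W consists of the x whose cycle
-- has vertex set W, so |K_W| = cycSum A W. Conversely, given a solution m,
-- K_W and the representatives with vertex set W have the same size, and
-- matching them position by position for every W yields a bijection φ from
-- the vertices of H onto the simple cycles up to rotation, under which x, y
-- lie in a common κ_v exactly when φ x and φ y share the vertex v.

module Submission where

open import Defs hiding (sym)
open import Data.Nat using (ℕ)
open import Data.Bool using (Bool)
open import Data.Fin using (Fin)
open import Data.Product using (∃; _×_)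

open import Level using (Level)
open import Function using (_∘_; _$_; id; flip; _⇔_)
open import Data.Empty using (⊥-elim)
open import Data.Unit using (tt)
open import Data.Sum using (_⊎_; inj₁; inj₂)
open import Data.Product using (Σ; ∃₂; _,_; proj₁; proj₂)
open import Data.Bool using (true; false; T; not; _∨_; if_then_else_) renaming (_≟_ to _≟ᵇ_)
open import Data.Nat using (zero; suc; _+_; _*_; _∸_; _≤_; _<_; z≤n; s≤s; NonZero)
open import Data.Nat.Properties
open import Data.Nat.DivMod using (_%_; _/_; m≡m%n+[m/n]*n; m%n<n)
open import Data.Nat.ListAction using (sum; product)
open import Data.Fin using (cast) renaming (_≟_ to _≟ᶠ_; zero to fzero; suc to fsuc)
open import Data.Fin.Properties using (cast-involutive)
open import Data.List
  using (List; []; _∷_; _++_; [_]; map; length; drop; take; head; concatMap; upTo; allFin; lookup; filterᵇ; cartesianProductWith)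
open import Data.List.Properties
  using ( ++-assoc; ++-identityʳ; ++-conicalʳ; take++drop≡id; ∷-injective; ∷-injectiveˡ; ∷-injectiveʳ
        ; map-++; map-cong; map-cong-local; map-∘; map-id; length-++; length-map; length-upTo)
open import Data.List.Relation.Unary.All using (All; []; _∷_)
import Data.List.Relation.Unary.All as All
import Data.List.Relation.Unary.All.Properties as All
open import Data.List.Relation.Unary.Any using (here; there; index)
import Data.List.Relation.Unary.Any.Properties as Any
open import Data.List.Relation.Unary.Any.Properties using (lookup-index)
open import Data.List.Relation.Unary.AllPairs using ([]; _∷_)
open import Data.List.Relation.Unary.Unique.Propositional using (Unique)
import Data.List.Relation.Unary.Unique.Propositional.Properties as Unique
open import Data.List.Membership.Propositional using (_∈_; _∉_; find; lose)
open import Data.List.Membership.Propositional.Properties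
  using ( ∈-++⁺ˡ; ∈-++⁺ʳ; ∈-++⁻; ∈-map⁺; ∈-map⁻; ∈-lookup; ∈-∃++; ∈-concatMap⁺; ∈-concatMap⁻
        ; ∈-upTo⁺; ∈-upTo⁻; ∈-allFin; ∈-filter⁺; ∈-filter⁻; ∈-cartesianProductWith⁺; ∈-cartesianProductWith⁻)
open import Data.List.Relation.Binary.Pointwise using (Pointwise; []; _∷_; Pointwise-length)
open import Data.Fin.Properties using (injective⇒≤)
open import Relation.Binary.Definitions using (_Respects_)
open import Relation.Binary.PropositionalEquality hiding ([_])
open import Relation.Nullary using (¬_; yes; no; contradiction; ⌊_⌋; toWitness; fromWitness)
open import Relation.Nullary.Decidable using (T?)
open import Data.Bool.Properties using (T-∧)
open import Data.Bool.ListAction using (all; any)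
open import Function.Bundles using (Equivalence; mk⇔)
open import Data.Maybe using (Maybe; just; nothing; maybe′)
open import Data.Vec using (Vec) renaming ([] to []ᵥ; _∷_ to _∷ᵥ_)
import Data.Vec as Vec
import Data.Vec.Properties as Vec

private
  variable
    a ℓ : Level
    A B : Set a

++-≡-++ : ∀ (xs ys us vs : List A) → xs ++ ys ≡ us ++ vs →
          (∃ λ ts → us ≡ xs ++ ts × ys ≡ ts ++ vs) ⊎ (∃ λ ts → xs ≡ us ++ ts × vs ≡ ts ++ ys)
++-≡-++ []       ys us       vs e = inj₁ (us , refl , e)
++-≡-++ (x ∷ xs) ys []       vs e = inj₂ (x ∷ xs , refl , sym e)
++-≡-++ (x ∷ xs) ys (u ∷ us) vs e with ∷-injective e
... | refl , e′ with ++-≡-++ xs ys us vs e′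
...   | inj₁ (ts , refl , q) = inj₁ (ts , refl , q)
...   | inj₂ (ts , refl , q) = inj₂ (ts , refl , q)

lookup-injective : ∀ {xs : List A} → Unique xs → ∀ {i j} → lookup xs i ≡ lookup xs j → i ≡ j
lookup-injective (_ ∷ _)     {fzero}  {fzero}  _ = refl
lookup-injective (x≢ ∷ _)    {fzero}  {fsuc j} e = contradiction e (All.lookup x≢ (∈-lookup j))
lookup-injective (x≢ ∷ _)    {fsuc i} {fzero}  e = contradiction (sym e) (All.lookup x≢ (∈-lookup i))
lookup-injective (_ ∷ uxs)   {fsuc i} {fsuc j} e = cong fsuc (lookup-injective uxs e)

Unique⇒length≤ : ∀ {n} {xs : List (Fin n)} → Unique xs → length xs ≤ n
Unique⇒length≤ uxs = injective⇒≤ (lookup-injective uxs)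

index-irrelevant : ∀ {xs : List A} {x} → Unique xs → (p q : x ∈ xs) → index p ≡ index q
index-irrelevant uxs p q = lookup-injective uxs (trans (sym (lookup-index p)) (lookup-index q))

map-≡⇒≡-on : ∀ {f g : A → B} {xs x} → map f xs ≡ map g xs → x ∈ xs → f x ≡ g x
map-≡⇒≡-on {xs = _ ∷ _} e (here refl) = ∷-injectiveˡ e
map-≡⇒≡-on {xs = _ ∷ _} e (there x∈) = map-≡⇒≡-on (∷-injectiveʳ e) x∈

Unique-map⁺-local : ∀ (f : A → B) {xs} → (∀ {x y} → x ∈ xs → y ∈ xs → f x ≡ f y → x ≡ y) →
                    Unique xs → Unique (map f xs)
Unique-map⁺-local f inj []                  = []
Unique-map⁺-local f {x ∷ xs} inj (x≢xs ∷ uxs) =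
  All.map⁺ (All.tabulate fx≢) ∷ Unique-map⁺-local f (λ p q → inj (there p) (there q)) uxs
  where
  fx≢ : ∀ {y} → y ∈ xs → f x ≢ f y
  fx≢ y∈ e = All.lookup x≢xs y∈ (inj (here refl) (there y∈) e)

Unique-concatMap⁺ : ∀ (f : A → List B) {xs} → Unique xs → (∀ {x} → x ∈ xs → Unique (f x)) →
                    (∀ {x y z} → x ∈ xs → y ∈ xs → z ∈ f x → z ∈ f y → x ≡ y) →
                    Unique (concatMap f xs)
Unique-concatMap⁺ f []                  _   _   = []
Unique-concatMap⁺ f {x ∷ xs} (x≢xs ∷ uxs) ufx sep =
  Unique.++⁺ (ufx (here refl)) (Unique-concatMap⁺ f uxs (ufx ∘ there) (λ p q → sep (there p) (there q))) disjoint
  where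
  disjoint : ∀ {z} → ¬ (z ∈ f x × z ∈ concatMap f xs)
  disjoint (z∈fx , z∈) with find (∈-concatMap⁻ f z∈)
  ... | y , y∈ , z∈fy = All.lookup x≢xs y∈ (sep (here refl) (there y∈) z∈fx z∈fy)

index-∈-lookup : ∀ {xs : List A} i → index (∈-lookup {xs = xs} i) ≡ i
index-∈-lookup {xs = _ ∷ _} fzero    = refl
index-∈-lookup {xs = _ ∷ _} (fsuc i) = cong fsuc (index-∈-lookup i)

module _ (xs : List A) (ys : List B) .(eq : length xs ≡ length ys) where

  partner : ∀ {x} → x ∈ xs → B
  partner x∈ = lookup ys (cast eq (index x∈))

  partner-∈ : ∀ {x} (x∈ : x ∈ xs) → partner x∈ ∈ ys
  partner-∈ x∈ = ∈-lookup _

  partner-injective : Unique ys → ∀ {x x′} (p : x ∈ xs) (q : x′ ∈ xs) → partner p ≡ partner q → x ≡ x′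
  partner-injective uys p q e = trans (lookup-index p) (trans (cong (lookup xs) index≡) (sym (lookup-index q)))
    where
    index≡ : index p ≡ index q
    index≡ = trans (sym (cast-involutive (sym eq) eq (index p)))
               (trans (cong (cast (sym eq)) (lookup-injective uys e)) (cast-involutive (sym eq) eq (index q)))

  partner-surjective : ∀ {y} → y ∈ ys → ∃ λ x → Σ (x ∈ xs) λ p → partner p ≡ y
  partner-surjective y∈ = _ , ∈-lookup {xs = xs} i , (begin
    lookup ys (cast eq (index (∈-lookup {xs = xs} i)))
      ≡⟨ cong (lookup ys ∘ cast eq) (index-∈-lookup {xs = xs} i) ⟩
    lookup ys (cast eq (cast (sym eq) (index y∈)))
      ≡⟨ cong (lookup ys) (cast-involutive eq (sym eq) (index y∈)) ⟩
    lookup ys (index y∈)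
      ≡⟨ sym (lookup-index y∈) ⟩
    _ ∎)
    where
    open ≡-Reasoning
    i : Fin (length xs)
    i = cast (sym eq) (index y∈)

length-≤-by : ∀ (R : A → B → Set ℓ) {xs : List A} {ys : List B} → Unique xs →
              (∀ {x} → x ∈ xs → ∃ λ y → y ∈ ys × R x y) →
              (∀ {x x′ y} → R x y → R x′ y → x ≡ x′) →
              length xs ≤ length ys
length-≤-by R {xs} {ys} uxs match injective = injective⇒≤ f-injective
  where
  f : Fin (length xs) → Fin (length ys)
  f i = index (proj₁ (proj₂ (match (∈-lookup i))))

  partner≡ : ∀ i → proj₁ (match (∈-lookup {xs = xs} i)) ≡ lookup ys (f i)
  partner≡ i = lookup-index (proj₁ (proj₂ (match (∈-lookup i))))

  f-injective : ∀ {i j} → f i ≡ f j → i ≡ j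
  f-injective {i} {j} e = lookup-injective uxs (injective Ri (subst (R _) (sym y≡) Rj))
    where
    Ri : R (lookup xs i) (proj₁ (match (∈-lookup i)))
    Ri = proj₂ (proj₂ (match (∈-lookup i)))
    Rj : R (lookup xs j) (proj₁ (match (∈-lookup j)))
    Rj = proj₂ (proj₂ (match (∈-lookup j)))
    y≡ : proj₁ (match (∈-lookup {xs = xs} i)) ≡ proj₁ (match (∈-lookup {xs = xs} j))
    y≡ = trans (partner≡ i) (trans (cong (lookup ys) e) (sym (partner≡ j)))

length-≡-by : ∀ (R : A → B → Set ℓ) {xs : List A} {ys : List B} → Unique xs → Unique ys →
              (∀ {x} → x ∈ xs → ∃ λ y → y ∈ ys × R x y) →
              (∀ {y} → y ∈ ys → ∃ λ x → x ∈ xs × R x y) →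
              (∀ {x x′ y} → R x y → R x′ y → x ≡ x′) →
              (∀ {x y y′} → R x y → R x y′ → y ≡ y′) →
              length xs ≡ length ys
length-≡-by R uxs uys matchˡ matchʳ injˡ injʳ =
  ≤-antisym (length-≤-by R uxs matchˡ injˡ) (length-≤-by (flip R) uys matchʳ injʳ)

Pointwise-map⁺ : ∀ {R : B → B → Set ℓ} (f g : A → B) {xs} → (∀ {x} → x ∈ xs → R (f x) (g x)) →
                 Pointwise R (map f xs) (map g xs)
Pointwise-map⁺ f g {[]}     r = []
Pointwise-map⁺ f g {x ∷ xs} r = r (here refl) ∷ Pointwise-map⁺ f g (r ∘ there)

length-cartesianProductWith : ∀ {C : Set ℓ} (f : A → B → C) xs ys →
  length (cartesianProductWith f xs ys) ≡ length xs * length ys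
length-cartesianProductWith f []       ys = refl
length-cartesianProductWith f (x ∷ xs) ys = begin
  length (map (f x) ys ++ cartesianProductWith f xs ys)  ≡⟨ length-++ (map (f x) ys) ⟩
  length (map (f x) ys) + length (cartesianProductWith f xs ys)
    ≡⟨ cong₂ _+_ (length-map (f x) ys) (length-cartesianProductWith f xs ys) ⟩
  length ys + length xs * length ys  ∎
  where open ≡-Reasoning

length-concatMap : ∀ (f : A → List B) xs → length (concatMap f xs) ≡ sum (map (length ∘ f) xs)
length-concatMap f []       = refl
length-concatMap f (x ∷ xs) = trans (length-++ (f x)) (cong (length (f x) +_) (length-concatMap f xs))

Rotation : List A → List A → Set _
Rotation xs ys = ∃₂ λ us vs → xs ≡ us ++ vs × ys ≡ vs ++ us

rotation-sym : ∀ {xs ys : List A} → Rotation xs ys → Rotation ys xs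
rotation-sym (us , vs , xs≡ , ys≡) = vs , us , ys≡ , xs≡

rotation-trans : ∀ {xs ys zs : List A} → Rotation xs ys → Rotation ys zs → Rotation xs zs
rotation-trans (us , vs , refl , ys≡) (us′ , vs′ , ys≡′ , refl)
  with ++-≡-++ vs us us′ vs′ (trans (sym ys≡) ys≡′)
... | inj₁ (ts , refl , refl) = ts , vs′ ++ vs , ++-assoc ts vs′ vs , sym (++-assoc vs′ vs ts)
... | inj₂ (ts , refl , refl) = us ++ us′ , ts , sym (++-assoc us us′ ts) , ++-assoc ts us us′

rotation-map : ∀ (f : A → B) {xs ys} → Rotation xs ys → Rotation (map f xs) (map f ys)
rotation-map f (us , vs , refl , refl) = map f us , map f vs , map-++ f us vs , map-++ f vs us

-- Every rotation is a composite of moves of the first element to the end.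
rotation-resp : ∀ {p} {P : List A → Set p} →
                (∀ {x xs} → P (x ∷ xs) → P (xs ++ [ x ])) → P Respects Rotation
rotation-resp {P = P} step (us , vs , refl , refl) = go us vs
  where
  go : ∀ us vs → P (us ++ vs) → P (vs ++ us)
  go []       vs p = subst P (sym (++-identityʳ vs)) p
  go (u ∷ us) vs p =
    subst P (++-assoc vs [ u ] us) (go us (vs ++ [ u ]) (subst P (++-assoc us vs [ u ]) (step p)))

∈-resp-rotation : ∀ {x : A} → (x ∈_) Respects Rotation
∈-resp-rotation = rotation-resp step
  where
  step : ∀ {x y ys} → x ∈ y ∷ ys → x ∈ ys ++ [ y ]
  step {ys = ys} (here refl) = ∈-++⁺ʳ ys (here refl)
  step           (there p)   = ∈-++⁺ˡ p

Unique-resp-rotation : Unique {A = A} Respects Rotation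
Unique-resp-rotation = rotation-resp step
  where
  step : ∀ {x xs} → Unique (x ∷ xs) → Unique (xs ++ [ x ])
  step u@(_ ∷ uxs) = Unique.++⁺ uxs ([] ∷ []) λ where
    (p , here refl) → contradiction p (Unique.Unique[x∷xs]⇒x∉xs u)

All-resp-rotation : ∀ {p} {P : A → Set p} → All P Respects Rotation
All-resp-rotation = rotation-resp λ where (px ∷ pxs) → All.++⁺ pxs (px ∷ [])

∈⇒rotation : ∀ {x : A} {xs} → x ∈ xs → ∃ λ ys → Rotation xs (x ∷ ys)
∈⇒rotation x∈xs with ∈-∃++ x∈xs
... | us , vs , xs≡ = vs ++ us , us , _ ∷ vs , xs≡ , refl

rotation-≡-by-head : ∀ (f : A → B) {x y xs ys} → Unique (map f (x ∷ xs)) → f x ≡ f y →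
                     Rotation (x ∷ xs) (y ∷ ys) → x ∷ xs ≡ y ∷ ys
rotation-≡-by-head f _ _ ([] , vs , xs≡ , ys≡) = trans xs≡ (sym (trans ys≡ (++-identityʳ vs)))
rotation-≡-by-head f _ _ (us , [] , xs≡ , ys≡) = trans xs≡ (trans (++-identityʳ us) (sym ys≡))
rotation-≡-by-head f {xs = xs} u fx≡fy (u′ ∷ us , v ∷ vs , xs≡ , ys≡)
  with ∷-injective xs≡ | ∷-injective ys≡
... | refl , xs≡′ | refl , _ =
  contradiction (subst (_∈ map f xs) (sym fx≡fy) (∈-map⁺ f (subst (v ∈_) (sym xs≡′) (∈-++⁺ʳ us (here refl)))))
                (Unique.Unique[x∷xs]⇒x∉xs u)

-- The least s < b with T (p s), or b if there is none.
search : (ℕ → Bool) → ℕ → ℕ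
search p zero    = zero
search p (suc b) = if p zero then zero else suc (search (p ∘ suc) b)

search-hit : ∀ (p : ℕ → Bool) b {t} → t < b → T (p t) → T (p (search p b))
search-hit p (suc b) {t} t<b pt with p zero in eq
... | true = subst T (sym eq) tt
search-hit p (suc b) {zero}  t<b pt | false = ⊥-elim (subst T eq pt)
search-hit p (suc b) {suc t} t<b pt | false = search-hit (p ∘ suc) b (≤-pred t<b) pt

search-least : ∀ (p : ℕ → Bool) b {r} → r < search p b → ¬ T (p r)
search-least p (suc b) {r} r<s pr with p zero in eq
search-least p (suc b) {zero}  r<s pr | false = subst T eq pr
search-least p (suc b) {suc r} r<s pr | false = search-least (p ∘ suc) b (≤-pred r<s) pr

module _ {n : ℕ} (σ : Fin n → Fin n) where

  iter-+ : ∀ s t x → iter σ (s + t) x ≡ iter σ s (iter σ t x)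
  iter-+ zero    t x = refl
  iter-+ (suc s) t x = cong σ (iter-+ s t x)

  iter-suc : ∀ t x → iter σ (suc t) x ≡ iter σ t (σ x)
  iter-suc zero    x = refl
  iter-suc (suc t) x = cong σ (iter-suc t x)

  iter-comm : ∀ s t x → iter σ s (iter σ t x) ≡ iter σ t (iter σ s x)
  iter-comm s t x = trans (sym (iter-+ s t x)) (trans (cong (λ k → iter σ k x) (+-comm s t)) (iter-+ t s x))

  iter-*-periodic : ∀ {p x} → iter σ p x ≡ x → ∀ q → iter σ (q * p) x ≡ x
  iter-*-periodic         closed zero    = refl
  iter-*-periodic {p} {x} closed (suc q) =
    trans (iter-+ p (q * p) x) (trans (cong (iter σ p) (iter-*-periodic closed q)) closed)

  iter-%-periodic : ∀ {p x} .{{_ : NonZero p}} → iter σ p x ≡ x → ∀ t → iter σ t x ≡ iter σ (t % p) x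
  iter-%-periodic {p} {x} closed t = begin
    iter σ t x                               ≡⟨ cong (λ k → iter σ k x) (m≡m%n+[m/n]*n t p) ⟩
    iter σ (t % p + (t / p) * p) x           ≡⟨ iter-+ (t % p) ((t / p) * p) x ⟩
    iter σ (t % p) (iter σ ((t / p) * p) x)  ≡⟨ cong (iter σ (t % p)) (iter-*-periodic closed (t / p)) ⟩
    iter σ (t % p) x                         ∎
    where open ≡-Reasoning

  orbit : Fin n → ℕ → List (Fin n)
  orbit u zero    = []
  orbit u (suc p) = u ∷ orbit (σ u) p

  ∈-orbit⁻ : ∀ {u x} p → x ∈ orbit u p → ∃ λ t → t < p × iter σ t u ≡ x
  ∈-orbit⁻ (suc p) (here refl) = zero , s≤s z≤n , refl
  ∈-orbit⁻ {u} (suc p) (there x∈) with ∈-orbit⁻ p x∈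
  ... | t , t<p , refl = suc t , s≤s t<p , iter-suc t u

  ∈-orbit⁺ : ∀ {u t} p → t < p → iter σ t u ∈ orbit u p
  ∈-orbit⁺     {t = zero}  (suc p) _         = here refl
  ∈-orbit⁺ {u} {t = suc t} (suc p) (s≤s t<p) = there (subst (_∈ _) (sym (iter-suc t u)) (∈-orbit⁺ p t<p))

  orbit-unique : ∀ {u} p → (∀ {i j} → i < j → j < p → iter σ i u ≢ iter σ j u) → Unique (orbit u p)
  orbit-unique         zero    distinct = []
  orbit-unique {u = u} (suc p) distinct =
    All.tabulate u∉ ∷ orbit-unique p λ {i} {j} i<j j<p e →
      distinct (s≤s i<j) (s≤s j<p) (trans (iter-suc i u) (trans e (sym (iter-suc j u))))
    where
    u∉ : ∀ {x} → x ∈ orbit (σ u) p → u ≢ x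
    u∉ x∈ with ∈-orbit⁻ p x∈
    ... | t , t<p , refl = λ e → distinct (s≤s z≤n) (s≤s t<p) (trans e (sym (iter-suc t u)))

  map-orbit : ∀ u p → map σ (orbit u p) ≡ orbit (σ u) p
  map-orbit u zero    = refl
  map-orbit u (suc p) = cong (σ u ∷_) (map-orbit (σ u) p)

  orbit-snoc : ∀ u p → orbit u (suc p) ≡ orbit u p ++ [ iter σ p u ]
  orbit-snoc u zero    = refl
  orbit-snoc u (suc p) =
    cong (u ∷_) (trans (orbit-snoc (σ u) p) (cong (λ x → orbit (σ u) p ++ [ x ]) (sym (iter-suc p u))))

  orbit-reach : ∀ {u x y} p → iter σ (suc p) u ≡ u → x ∈ orbit u (suc p) → y ∈ orbit u (suc p) →
                ∃ λ t → t < suc p × iter σ t x ≡ y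
  orbit-reach {u} p closed x∈ y∈ with ∈-orbit⁻ (suc p) x∈ | ∈-orbit⁻ (suc p) y∈
  ... | i , i<p , refl | j , _ , refl = t % suc p , m%n<n t (suc p) , (begin
    iter σ (t % suc p) (iter σ i u)  ≡⟨ sym (iter-%-periodic x-closed t) ⟩
    iter σ t (iter σ i u)            ≡⟨ sym (iter-+ t i u) ⟩
    iter σ (t + i) u                 ≡⟨ cong (λ k → iter σ k u) t+i≡j+p ⟩
    iter σ (j + suc p) u             ≡⟨ iter-+ j (suc p) u ⟩
    iter σ j (iter σ (suc p) u)      ≡⟨ cong (iter σ j) closed ⟩
    iter σ j u                       ∎)
    where
    open ≡-Reasoning
    -- p + 1 − i + j steps lead from σ^i u through u to σ^j u; then reduce modulo the period.
    t : ℕ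
    t = (suc p ∸ i) + j
    t+i≡j+p : t + i ≡ j + suc p
    t+i≡j+p = begin
      (suc p ∸ i) + j + i    ≡⟨ cong (_+ i) (+-comm (suc p ∸ i) j) ⟩
      j + (suc p ∸ i) + i    ≡⟨ +-assoc j (suc p ∸ i) i ⟩
      j + ((suc p ∸ i) + i)  ≡⟨ cong (j +_) (m∸n+n≡m (<⇒≤ i<p)) ⟩
      j + suc p              ∎
    x-closed : iter σ (suc p) (iter σ i u) ≡ iter σ i u
    x-closed = trans (iter-comm (suc p) i u) (cong (iter σ i) closed)

  -- Following σ from u runs through zs and ends at e.
  Walk : Fin n → List (Fin n) → Fin n → Set
  Walk u zs e = map σ (u ∷ zs) ≡ zs ++ [ e ]

  orbit-walk : ∀ u p → Walk u (orbit (σ u) p) (iter σ (suc p) u)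
  orbit-walk u p = trans (map-orbit u (suc p))
    (trans (orbit-snoc (σ u) p) (cong (λ x → orbit (σ u) p ++ [ x ]) (sym (iter-suc p u))))

  walk⇒orbit : ∀ {u e} zs → Walk u zs e →
               u ∷ zs ≡ orbit u (suc (length zs)) × iter σ (suc (length zs)) u ≡ e
  walk⇒orbit []       w = refl , ∷-injectiveˡ w
  walk⇒orbit {u} (z ∷ zs) w with ∷-injective w
  ... | refl , w′ with walk⇒orbit zs w′
  ...   | zs≡ , end≡ = cong (u ∷_) zs≡ , trans (iter-suc (suc (length zs)) u) end≡

  walk-unique : ∀ {u e} xs ys → Walk u xs e → Walk u ys e → e ∉ xs → e ∉ ys → xs ≡ ys
  walk-unique []       []       _  _  _   _   = refl
  walk-unique []       (y ∷ ys) wx wy _   e∉ys =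
    contradiction (here (trans (sym (∷-injectiveˡ wx)) (∷-injectiveˡ wy))) e∉ys
  walk-unique (x ∷ xs) []       wx wy e∉xs _   =
    contradiction (here (trans (sym (∷-injectiveˡ wy)) (∷-injectiveˡ wx))) e∉xs
  walk-unique {u} (x ∷ xs) (y ∷ ys) wx wy e∉xs e∉ys with ∷-injective wx | ∷-injective wy
  ... | refl , wx′ | refl , wy′ =
    cong (σ u ∷_) (walk-unique xs ys wx′ wy′ (e∉xs ∘ there) (e∉ys ∘ there))

choices : List ℕ → List (List ℕ)
choices []       = [ [] ]
choices (b ∷ bs) = cartesianProductWith _∷_ (upTo b) (choices bs)

length-choices : ∀ bs → length (choices bs) ≡ product bs
length-choices []       = refl
length-choices (b ∷ bs) = trans (length-cartesianProductWith _∷_ (upTo b) (choices bs))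
                                (cong₂ _*_ (length-upTo b) (length-choices bs))

∈-choices⁺ : ∀ {cs bs} → Pointwise _<_ cs bs → cs ∈ choices bs
∈-choices⁺ []            = here refl
∈-choices⁺ (c<b ∷ cs<bs) = ∈-cartesianProductWith⁺ _∷_ (∈-upTo⁺ c<b) (∈-choices⁺ cs<bs)

∈-choices⁻ : ∀ bs {cs} → cs ∈ choices bs → Pointwise _<_ cs bs
∈-choices⁻ []       (here refl) = []
∈-choices⁻ (b ∷ bs) cs∈ with ∈-cartesianProductWith⁻ _∷_ (upTo b) (choices bs) cs∈
... | _ , _ , c∈ , cs∈′ , refl = ∈-upTo⁻ c∈ ∷ ∈-choices⁻ bs cs∈′

choices-unique : ∀ bs → Unique (choices bs)
choices-unique []       = [] ∷ []
choices-unique (b ∷ bs) =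
  Unique.cartesianProductWith⁺ _∷_ ∷-injective (Unique.upTo⁺ b) (choices-unique bs)

allVecs-suc : ∀ n m → allVecs n (suc m) ≡ cartesianProductWith _∷ᵥ_ (allFin n) (allVecs n m)
allVecs-suc n m = concatMap-map-cartesian (allFin n)
  where
  concatMap-map-cartesian : ∀ xs → concatMap (λ x → map (x ∷ᵥ_) (allVecs n m)) xs
                                   ≡ cartesianProductWith _∷ᵥ_ xs (allVecs n m)
  concatMap-map-cartesian []       = refl
  concatMap-map-cartesian (x ∷ xs) = cong (map (x ∷ᵥ_) (allVecs n m) ++_) (concatMap-map-cartesian xs)

∈-allVecs : ∀ {n} m (v : Vec (Fin n) m) → v ∈ allVecs n m
∈-allVecs zero    []ᵥ       = here refl
∈-allVecs {n} (suc m) (x ∷ᵥ v) =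
  subst (_ ∈_) (sym (allVecs-suc n m)) (∈-cartesianProductWith⁺ _∷ᵥ_ (∈-allFin x) (∈-allVecs m v))

allVecs-unique : ∀ n m → Unique (allVecs n m)
allVecs-unique n zero    = [] ∷ []
allVecs-unique n (suc m) = subst Unique (sym (allVecs-suc n m)) $
  Unique.cartesianProductWith⁺ _∷ᵥ_ Vec.∷-injective (Unique.allFin⁺ n) (allVecs-unique n m)

-- Pointwise equal functions have equal tabulations, so tabulated maps can be
-- compared with ≡.
tabulated : ∀ {n} → (Fin n → A) → Fin n → A
tabulated f = Vec.lookup (Vec.tabulate f)

tabulated-≗ : ∀ {n} (f : Fin n → A) → tabulated f ≗ f
tabulated-≗ = Vec.lookup∘tabulate

tabulated-cong : ∀ {n} {f g : Fin n → A} → f ≗ g → tabulated f ≡ tabulated g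
tabulated-cong f≗g = cong Vec.lookup (Vec.tabulate-cong f≗g)

lookup-≗⇒≡ : ∀ {m} {u v : Vec A m} → Vec.lookup u ≗ Vec.lookup v → u ≡ v
lookup-≗⇒≡ {u = u} {v} u≗v =
  trans (sym (Vec.tabulate∘lookup u)) (trans (Vec.tabulate-cong u≗v) (Vec.tabulate∘lookup v))

∈-allMaps : ∀ {n} (f : Fin n → Fin n) → tabulated f ∈ allMaps n
∈-allMaps {n} f = ∈-map⁺ Vec.lookup (∈-allVecs n (Vec.tabulate f))

allMaps-unique : ∀ n → Unique (allMaps n)
allMaps-unique n = Unique.map⁺ (λ e → lookup-≗⇒≡ (λ i → cong (λ f → f i) e)) (allVecs-unique n n)

allMaps-≗⇒≡ : ∀ {n} {σ σ′ : Fin n → Fin n} → σ ∈ allMaps n → σ′ ∈ allMaps n → σ ≗ σ′ → σ ≡ σ′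
allMaps-≗⇒≡ σ∈ σ′∈ σ≗σ′ with ∈-map⁻ Vec.lookup σ∈ | ∈-map⁻ Vec.lookup σ′∈
... | u , _ , refl | v , _ , refl = cong Vec.lookup (lookup-≗⇒≡ {u = u} {v} σ≗σ′)

T-ext : ∀ {x y : Bool} → (T x → T y) → (T y → T x) → x ≡ y
T-ext {false} {false} _ _ = refl
T-ext {false} {true}  _ g = ⊥-elim (g tt)
T-ext {true}  {false} f _ = ⊥-elim (f tt)
T-ext {true}  {true}  _ _ = refl

T-not-∨⇒ : ∀ {x y} → T (not x ∨ y) → T x → T y
T-not-∨⇒ {true} t _ = t

⇒T-not-∨ : ∀ {x y} → (T x → T y) → T (not x ∨ y)
⇒T-not-∨ {true}  f = f tt
⇒T-not-∨ {false} _ = tt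

module _ {n : ℕ} (p : Fin n → Bool) where

  T-all-allFin⁻ : T (all p (allFin n)) → ∀ v → T (p v)
  T-all-allFin⁻ t v = All.lookup (All.all⁺ p (allFin n) t) (∈-allFin v)

  T-all-allFin⁺ : (∀ v → T (p v)) → T (all p (allFin n))
  T-all-allFin⁺ h = All.all⁻ p {allFin n} (All.tabulate (λ {v} _ → h v))

drop-length-++ : ∀ (xs ys : List A) → drop (length xs) (xs ++ ys) ≡ ys
drop-length-++ []       ys = refl
drop-length-++ (x ∷ xs) ys = drop-length-++ xs ys

take-length-++ : ∀ (xs ys : List A) → take (length xs) (xs ++ ys) ≡ xs
take-length-++ []       ys = refl
take-length-++ (x ∷ xs) ys = cong (x ∷_) (take-length-++ xs ys)

module _ {n : ℕ} where

  open import Data.List.Membership.DecPropositional (_≟ᶠ_ {n}) using (_∈?_)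

  vertices : List (Arc n) → List (Fin n)
  vertices = map src

  vertexSet : List (Arc n) → Fin n → Bool
  vertexSet l v = ⌊ v ∈? vertices l ⌋

  vertexSet⁺ : ∀ {l v} → v ∈ vertices l → T (vertexSet l v)
  vertexSet⁺ = fromWitness

  vertexSet⁻ : ∀ {l v} → T (vertexSet l v) → v ∈ vertices l
  vertexSet⁻ = toWitness

  vertexSet-resp-rotation : ∀ {l l′} → Rotation l l′ → vertexSet l ≗ vertexSet l′
  vertexSet-resp-rotation {l} {l′} rot v =
    T-ext (vertexSet⁺ {l′} ∘ ∈-resp-rotation (rotation-map src rot) ∘ vertexSet⁻ {l})
          (vertexSet⁺ {l} ∘ ∈-resp-rotation (rotation-map src (rotation-sym rot)) ∘ vertexSet⁻ {l′})

  successor-rotate : ∀ a l → map tgt (a ∷ l) ≡ drop 1 (vertices (a ∷ l)) ++ take 1 (vertices (a ∷ l)) →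
                     map tgt (l ++ [ a ]) ≡ drop 1 (vertices (l ++ [ a ])) ++ take 1 (vertices (l ++ [ a ]))
  successor-rotate a []      succ = succ
  successor-rotate a (b ∷ l) succ with ∷-injective succ
  ... | tgt-a≡src-b , succ′ = begin
    tgt b ∷ map tgt (l ++ [ a ])             ≡⟨ cong (tgt b ∷_) (map-++ tgt l [ a ]) ⟩
    (tgt b ∷ map tgt l) ++ [ tgt a ]         ≡⟨ cong₂ (λ xs x → xs ++ [ x ]) succ′ tgt-a≡src-b ⟩
    (vertices l ++ [ src a ]) ++ [ src b ]   ≡⟨ cong (_++ [ src b ]) (sym (map-++ src l [ a ])) ⟩
    vertices (l ++ [ a ]) ++ [ src b ]       ∎
    where open ≡-Reasoning

  IsSimpleCycle-resp-rotation : ∀ {A : Fin n → Fin n → ℕ} → IsSimpleCycle A Respects Rotation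
  IsSimpleCycle-resp-rotation {A} = rotation-resp step
    where
    step : ∀ {a l} → IsSimpleCycle A (a ∷ l) → IsSimpleCycle A (l ++ [ a ])
    step {a} {l} (_ , valid , succ , distinct) =
      (λ ()) ∘ ++-conicalʳ l [ a ] ,
      All-resp-rotation ([ a ] , l , refl , refl) valid ,
      successor-rotate a l succ ,
      subst Unique (sym (map-++ src l [ a ])) (Unique-resp-rotation ([ src a ] , vertices l , refl , refl) distinct)

  module _ {A : Fin n → Fin n → ℕ} {c c′ : SimpleCycle A} where

    ≈ᶜ⇒rotation : c ≈ᶜ c′ → Rotation (proj₁ c) (proj₁ c′)
    ≈ᶜ⇒rotation (r , e) = take r (proj₁ c) , drop r (proj₁ c) , sym (take++drop≡id r (proj₁ c)) , e

    rotation⇒≈ᶜ : Rotation (proj₁ c) (proj₁ c′) → c ≈ᶜ c′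
    rotation⇒≈ᶜ (us , vs , c≡ , c′≡) = length us , (begin
      proj₁ c′
        ≡⟨ c′≡ ⟩
      vs ++ us
        ≡⟨ cong₂ _++_ (sym (drop-length-++ us vs)) (sym (take-length-++ us vs)) ⟩
      drop (length us) (us ++ vs) ++ take (length us) (us ++ vs)
        ≡⟨ cong (λ l → drop (length us) l ++ take (length us) l) (sym c≡) ⟩
      drop (length us) (proj₁ c) ++ take (length us) (proj₁ c) ∎)
      where open ≡-Reasoning

record IsCyclicOn {n : ℕ} (W : Fin n → Bool) (σ : Fin n → Fin n) : Set where
  field
    into    : ∀ {v} → T (W v) → T (W (σ v))
    fixes   : ∀ {v} → W v ≡ false → σ v ≡ v
    reaches : ∀ {w v} → T (W w) → T (W v) → ∃ λ t → t < n × iter σ t w ≡ v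

module _ {n : ℕ} (σ : Fin n → Fin n) where

  returns : Fin n → ℕ → Bool
  returns w r = ⌊ iter σ (suc r) w ≟ᶠ w ⌋

  -- The first return time of w under σ: the least t ≥ 1 with σ^t w = w.
  returnTime : Fin n → ℕ
  returnTime w = suc (search (returns w) n)

  cycleThrough : Fin n → List (Fin n)
  cycleThrough w = orbit σ w (returnTime w)

module _ {n : ℕ} {W : Fin n → Bool} {σ : Fin n → Fin n} where

  isCyc⇒IsCyclicOn : T (isCyc W σ) → IsCyclicOn W σ
  isCyc⇒IsCyclicOn cyc = record { into = into ; fixes = fixes ; reaches = reaches }
    where
    stable : ∀ v → T (if W v then W (σ v) else ⌊ σ v ≟ᶠ v ⌋)
    stable = T-all-allFin⁻ _ (proj₁ (Equivalence.to T-∧ cyc))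

    connected : ∀ w → T (not (W w) ∨
                           all (λ v → not (W v) ∨ any (λ t → ⌊ iter σ t w ≟ᶠ v ⌋) (upTo n)) (allFin n))
    connected = T-all-allFin⁻ _ (proj₂ (Equivalence.to T-∧ cyc))

    into : ∀ {v} → T (W v) → T (W (σ v))
    into {v} Wv with W v | stable v
    ... | true | t = t

    fixes : ∀ {v} → W v ≡ false → σ v ≡ v
    fixes {v} Wv≡false = toWitness (subst (λ b → T (if b then W (σ v) else ⌊ σ v ≟ᶠ v ⌋)) Wv≡false (stable v))

    reaches : ∀ {w v} → T (W w) → T (W v) → ∃ λ t → t < n × iter σ t w ≡ v
    reaches {w} {v} Ww Wv
      with find (Any.any⁻ (λ t → ⌊ iter σ t w ≟ᶠ v ⌋) (upTo n)
                  (T-not-∨⇒ (T-all-allFin⁻ (λ v → not (W v) ∨ any (λ t → ⌊ iter σ t w ≟ᶠ v ⌋) (upTo n))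
                                            (T-not-∨⇒ (connected w) Ww) v) Wv))
    ... | t , t∈ , hit = t , ∈-upTo⁻ t∈ , toWitness hit

  IsCyclicOn⇒isCyc : IsCyclicOn W σ → T (isCyc W σ)
  IsCyclicOn⇒isCyc cyc = Equivalence.from T-∧ (T-all-allFin⁺ _ stable , T-all-allFin⁺ _ connected)
    where
    open IsCyclicOn cyc

    stable : ∀ v → T (if W v then W (σ v) else ⌊ σ v ≟ᶠ v ⌋)
    stable v with W v in eq
    ... | true  = into (subst T (sym eq) tt)
    ... | false = fromWitness (fixes eq)

    connected : ∀ w → T (not (W w) ∨
                           all (λ v → not (W v) ∨ any (λ t → ⌊ iter σ t w ≟ᶠ v ⌋) (upTo n)) (allFin n))
    connected w = ⇒T-not-∨ λ Ww → T-all-allFin⁺ _ λ v → ⇒T-not-∨ λ Wv →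
      let t , t<n , hit = reaches Ww Wv
      in Any.any⁺ (λ t → ⌊ iter σ t w ≟ᶠ v ⌋) (lose (∈-upTo⁺ t<n) (fromWitness hit))

module _ {n : ℕ} {W : Fin n → Bool} {σ : Fin n → Fin n} (cyc : IsCyclicOn W σ) {w : Fin n} (Ww : T (W w)) where

  open IsCyclicOn cyc

  private
    s : ℕ
    s = search (returns σ w) n

  returnTime-closed : iter σ (returnTime σ w) w ≡ w
  returnTime-closed with reaches (into Ww) Ww
  ... | t , t<n , hit = toWitness (search-hit (returns σ w) n t<n (fromWitness (trans (iter-suc σ t w) hit)))

  cycleThrough-walk : Walk σ w (orbit σ (σ w) s) w
  cycleThrough-walk = subst (Walk σ w (orbit σ (σ w) s)) returnTime-closed (orbit-walk σ w s)

  cycleThrough-unique : Unique (cycleThrough σ w)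
  cycleThrough-unique = orbit-unique σ (returnTime σ w) distinct
    where
    distinct : ∀ {i j} → i < j → j < returnTime σ w → iter σ i w ≢ iter σ j w
    distinct {i} {j} i<j (s≤s j≤s) e = search-least (returns σ w) n r<s (fromWitness closes)
      where
      -- From σ^i w = σ^j w, w already returns after s + 1 − (j − i) steps.
      r : ℕ
      r = s ∸ j + i
      r<s : r < s
      r<s = subst (r <_) (m∸n+n≡m j≤s) (+-monoʳ-< (s ∸ j) i<j)
      closes : iter σ (suc r) w ≡ w
      closes = begin
        iter σ (suc (s ∸ j) + i) w        ≡⟨ iter-+ σ (suc (s ∸ j)) i w ⟩
        iter σ (suc (s ∸ j)) (iter σ i w) ≡⟨ cong (iter σ (suc (s ∸ j))) e ⟩
        iter σ (suc (s ∸ j)) (iter σ j w) ≡⟨ sym (iter-+ σ (suc (s ∸ j)) j w) ⟩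
        iter σ (suc (s ∸ j + j)) w        ≡⟨ cong (λ k → iter σ (suc k) w) (m∸n+n≡m j≤s) ⟩
        iter σ (returnTime σ w) w         ≡⟨ returnTime-closed ⟩
        w                                 ∎
        where open ≡-Reasoning

  ∈-cycleThrough⁻ : ∀ {v} → v ∈ cycleThrough σ w → T (W v)
  ∈-cycleThrough⁻ v∈ with ∈-orbit⁻ σ (returnTime σ w) v∈
  ... | t , _ , refl = iterate-into t
    where
    iterate-into : ∀ t → T (W (iter σ t w))
    iterate-into zero    = Ww
    iterate-into (suc t) = into (iterate-into t)

  ∈-cycleThrough⁺ : ∀ {v} → T (W v) → v ∈ cycleThrough σ w
  ∈-cycleThrough⁺ Wv with reaches Ww Wv
  ... | t , _ , refl = subst (_∈ cycleThrough σ w) (sym (iter-%-periodic σ returnTime-closed t))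
                             (∈-orbit⁺ σ (returnTime σ w) (m%n<n t (returnTime σ w)))

module _ {n : ℕ} where

  lab : Arc n → ℕ
  lab (_ , _ , t) = t

  arcFrom : List (Arc n) → Fin n → Maybe (Arc n)
  arcFrom []      v = nothing
  arcFrom (a ∷ l) v with src a ≟ᶠ v
  ... | yes _ = just a
  ... | no  _ = arcFrom l v

  arcFrom-∈ : ∀ {l a} → Unique (vertices l) → a ∈ l → arcFrom l (src a) ≡ just a
  arcFrom-∈ {b ∷ l} {a} _ a∈ with src b ≟ᶠ src a
  arcFrom-∈ (_ ∷ _)     (here refl) | yes _ = refl
  arcFrom-∈ (src≢ ∷ _)  (there a∈)  | yes e = contradiction e (All.lookup src≢ (∈-map⁺ src a∈))
  arcFrom-∈ _           (here refl) | no ne = contradiction refl ne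
  arcFrom-∈ (_ ∷ u)     (there a∈)  | no _  = arcFrom-∈ u a∈

  arcFrom-∉ : ∀ {l v} → v ∉ vertices l → arcFrom l v ≡ nothing
  arcFrom-∉ {[]}    _  = refl
  arcFrom-∉ {a ∷ l} {v} v∉ with src a ≟ᶠ v
  ... | yes e = contradiction (here (sym e)) v∉
  ... | no  _ = arcFrom-∉ (v∉ ∘ there)

  -- Tabulated so that it is literally an element of allMaps n.
  successorMap : List (Arc n) → Fin n → Fin n
  successorMap l = tabulated (λ v → maybe′ tgt v (arcFrom l v))

  successorMap-∈ : ∀ {l a} → Unique (vertices l) → a ∈ l → successorMap l (src a) ≡ tgt a
  successorMap-∈ {l} {a} u a∈ =
    trans (tabulated-≗ _ (src a)) (cong (maybe′ tgt (src a)) (arcFrom-∈ u a∈))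

  successorMap-∉ : ∀ {l v} → v ∉ vertices l → successorMap l v ≡ v
  successorMap-∉ {l} {v} v∉ = trans (tabulated-≗ _ v) (cong (maybe′ tgt v) (arcFrom-∉ v∉))

  labelMap : List (Arc n) → Fin n → ℕ
  labelMap l v = maybe′ lab 0 (arcFrom l v)

  labelMap-∈ : ∀ {l a} → Unique (vertices l) → a ∈ l → labelMap l (src a) ≡ lab a
  labelMap-∈ u a∈ = cong (maybe′ lab 0) (arcFrom-∈ u a∈)

  assign : List (Fin n) → List ℕ → Fin n → ℕ
  assign (w ∷ ws) (c ∷ cs) u with w ≟ᶠ u
  ... | yes _ = c
  ... | no  _ = assign ws cs u
  assign _ _ _ = 0

  assign-< : ∀ (g : Fin n → ℕ) {ws cs} → Pointwise _<_ cs (map g ws) → ∀ {u} → u ∈ ws → assign ws cs u < g u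
  assign-< g {w ∷ ws} (c<gw ∷ cs<) {u} u∈ with w ≟ᶠ u
  assign-< g {w ∷ ws} (c<gw ∷ cs<) {u} u∈          | yes refl = c<gw
  assign-< g {w ∷ ws} (c<gw ∷ cs<) {u} (here refl) | no w≢u   = contradiction refl w≢u
  assign-< g {w ∷ ws} (c<gw ∷ cs<) {u} (there u∈)  | no _     = assign-< g cs< u∈

  assign-map : ∀ (h : Fin n → ℕ) {ws u} → u ∈ ws → assign ws (map h ws) u ≡ h u
  assign-map h {w ∷ ws} {u} u∈ with w ≟ᶠ u
  assign-map h {w ∷ ws} {u} u∈          | yes refl = refl
  assign-map h {w ∷ ws} {u} (here refl) | no w≢u   = contradiction refl w≢u
  assign-map h {w ∷ ws} {u} (there u∈)  | no _     = assign-map h u∈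

  map-assign : ∀ {ws cs} → Unique ws → length cs ≡ length ws → map (assign ws cs) ws ≡ cs
  map-assign {[]}     {[]}     _            _ = refl
  map-assign {w ∷ ws} {c ∷ cs} (w≢ws ∷ uws) e with w ≟ᶠ w
  ... | no w≢w = contradiction refl w≢w
  ... | yes _  = cong (c ∷_) (trans (map-cong-local (All.tabulate skip)) (map-assign uws (suc-injective e)))
    where
    skip : ∀ {u} → u ∈ ws → assign (w ∷ ws) (c ∷ cs) u ≡ assign ws cs u
    skip {u} u∈ with w ≟ᶠ u
    ... | yes refl = contradiction refl (All.lookup w≢ws u∈)
    ... | no  _    = refl

-- Representatives of the simple cycles with a given vertex set

NonEmpty : ∀ {n} → (Fin n → Bool) → Set
NonEmpty W = ∃ λ v → T (W v)

record CycleTransversal {n : ℕ} (m : Fin n → Fin n → ℕ) (W : Fin n → Bool) (L : List (List (Arc n))) : Set where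
  field
    unique     : Unique L
    simple     : ∀ {l} → l ∈ L → IsSimpleCycle m l
    vertexSet≗ : ∀ {l} → l ∈ L → vertexSet l ≗ W
    separated  : ∀ {l l′} → l ∈ L → l′ ∈ L → Rotation l l′ → l ≡ l′
    complete   : ∀ {l} → IsSimpleCycle m l → vertexSet l ≗ W → ∃ λ l′ → l′ ∈ L × Rotation l l′

data StartsAt {n : ℕ} (w : Fin n) : List (Arc n) → Set where
  startsAt : ∀ j t l → StartsAt w ((w , j , t) ∷ l)

module CyclesThrough {n : ℕ} (m : Fin n → Fin n → ℕ) (W : Fin n → Bool) (w₀ : Fin n) where

  ws : List (Fin n)
  ws = filterᵇ W (allFin n)

  bounds : (Fin n → Fin n) → List ℕ
  bounds σ = map (λ v → m v (σ v)) ws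

  arcsAlong : (Fin n → Fin n) → List ℕ → List (Arc n)
  arcsAlong σ cs = map (λ u → u , σ u , assign ws cs u) (cycleThrough σ w₀)

  cyclesAlong : (Fin n → Fin n) → List (List (Arc n))
  cyclesAlong σ = map (arcsAlong σ) (choices (bounds σ))

  cycles : List (List (Arc n))
  cycles = concatMap cyclesAlong (Cyc W)

  length-cycles : length cycles ≡ cycSum m W
  length-cycles = trans (length-concatMap cyclesAlong (Cyc W))
    (cong sum (map-cong (λ σ → trans (length-map (arcsAlong σ) (choices (bounds σ)))
                                     (length-choices (bounds σ))) (Cyc W)))

  vertices-arcsAlong : ∀ σ cs → vertices (arcsAlong σ cs) ≡ cycleThrough σ w₀
  vertices-arcsAlong σ cs = trans (sym (map-∘ (cycleThrough σ w₀))) (map-id (cycleThrough σ w₀))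

  targets-arcsAlong : ∀ σ cs → map tgt (arcsAlong σ cs) ≡ map σ (cycleThrough σ w₀)
  targets-arcsAlong σ cs = sym (map-∘ (cycleThrough σ w₀))

  labels-arcsAlong : ∀ σ cs → map lab (arcsAlong σ cs) ≡ map (assign ws cs) (cycleThrough σ w₀)
  labels-arcsAlong σ cs = sym (map-∘ (cycleThrough σ w₀))

  ∈-ws⁺ : ∀ {v} → T (W v) → v ∈ ws
  ∈-ws⁺ Wv = ∈-filter⁺ (T? ∘ W) {xs = allFin n} (∈-allFin _) Wv

  ∈-ws⁻ : ∀ {v} → v ∈ ws → T (W v)
  ∈-ws⁻ v∈ = proj₂ (∈-filter⁻ (T? ∘ W) {xs = allFin n} v∈)

  ws-unique : Unique ws
  ws-unique = Unique.filter⁺ (T? ∘ W) (Unique.allFin⁺ n)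

  ∈-Cyc⇒IsCyclicOn : ∀ {σ} → σ ∈ Cyc W → IsCyclicOn W σ
  ∈-Cyc⇒IsCyclicOn σ∈ = isCyc⇒IsCyclicOn (proj₂ (∈-filter⁻ (T? ∘ isCyc W) {xs = allMaps n} σ∈))

  module _ (Ww₀ : T (W w₀)) where

    module _ {σ : Fin n → Fin n} {cs : List ℕ} (cyc : IsCyclicOn W σ) where

      arcsAlong-simple : cs ∈ choices (bounds σ) → IsSimpleCycle m (arcsAlong σ cs)
      arcsAlong-simple cs∈ = (λ ()) , valid , successive , distinct
        where
        valid : All (ValidArc m) (arcsAlong σ cs)
        valid = All.map⁺ (All.tabulate λ u∈ →
          assign-< (λ v → m v (σ v)) (∈-choices⁻ (bounds σ) cs∈) (∈-ws⁺ (∈-cycleThrough⁻ cyc Ww₀ u∈)))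
        successive : map tgt (arcsAlong σ cs) ≡ drop 1 (vertices (arcsAlong σ cs)) ++ take 1 (vertices (arcsAlong σ cs))
        successive = trans (targets-arcsAlong σ cs) (trans (cycleThrough-walk cyc Ww₀)
          (cong (λ vs → drop 1 vs ++ take 1 vs) (sym (vertices-arcsAlong σ cs))))
        distinct : Unique (vertices (arcsAlong σ cs))
        distinct = subst Unique (sym (vertices-arcsAlong σ cs)) (cycleThrough-unique cyc Ww₀)

      arcsAlong-vertexSet : vertexSet (arcsAlong σ cs) ≗ W
      arcsAlong-vertexSet v =
        T-ext (∈-cycleThrough⁻ cyc Ww₀ ∘ subst (v ∈_) (vertices-arcsAlong σ cs)
                                       ∘ vertexSet⁻ {l = arcsAlong σ cs})
              (vertexSet⁺ {l = arcsAlong σ cs} ∘ subst (v ∈_) (sym (vertices-arcsAlong σ cs))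
                                               ∘ ∈-cycleThrough⁺ cyc Ww₀)

    ∈-cycles⁻ : ∀ {l} → l ∈ cycles →
                ∃₂ λ σ cs → σ ∈ Cyc W × cs ∈ choices (bounds σ) × l ≡ arcsAlong σ cs
    ∈-cycles⁻ l∈ with find (∈-concatMap⁻ cyclesAlong {xs = Cyc W} l∈)
    ... | σ , σ∈ , l∈′ with ∈-map⁻ (arcsAlong σ) l∈′
    ...   | cs , cs∈ , refl = σ , cs , σ∈ , cs∈ , refl

    cycles-simple : ∀ {l} → l ∈ cycles → IsSimpleCycle m l
    cycles-simple l∈ with ∈-cycles⁻ l∈
    ... | σ , cs , σ∈ , cs∈ , refl = arcsAlong-simple (∈-Cyc⇒IsCyclicOn σ∈) cs∈

    cycles-vertexSet : ∀ {l} → l ∈ cycles → vertexSet l ≗ W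
    cycles-vertexSet l∈ with ∈-cycles⁻ l∈
    ... | σ , cs , σ∈ , cs∈ , refl = arcsAlong-vertexSet (∈-Cyc⇒IsCyclicOn σ∈)

    cycles-startsAt : ∀ {l} → l ∈ cycles → StartsAt w₀ l
    cycles-startsAt l∈ with ∈-cycles⁻ l∈
    ... | σ , cs , σ∈ , cs∈ , refl = startsAt _ _ _

    arcsAlong-injective : ∀ {σ} → σ ∈ Cyc W → ∀ {cs cs′} →
                          cs ∈ choices (bounds σ) → cs′ ∈ choices (bounds σ) →
                          arcsAlong σ cs ≡ arcsAlong σ cs′ → cs ≡ cs′
    arcsAlong-injective {σ} σ∈ {cs} {cs′} cs∈ cs′∈ e = begin
      cs                       ≡⟨ sym (map-assign ws-unique (length≡ cs∈)) ⟩
      map (assign ws cs) ws    ≡⟨ map-cong-local (All.tabulate (map-≡⇒≡-on labels≡ ∘ ∈-cycle ∘ ∈-ws⁻)) ⟩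
      map (assign ws cs′) ws   ≡⟨ map-assign ws-unique (length≡ cs′∈) ⟩
      cs′                      ∎
      where
      open ≡-Reasoning
      length≡ : ∀ {cs} → cs ∈ choices (bounds σ) → length cs ≡ length ws
      length≡ cs∈ = trans (Pointwise-length (∈-choices⁻ (bounds σ) cs∈)) (length-map _ ws)
      ∈-cycle : ∀ {v} → T (W v) → v ∈ cycleThrough σ w₀
      ∈-cycle = ∈-cycleThrough⁺ (∈-Cyc⇒IsCyclicOn σ∈) Ww₀
      labels≡ : map (assign ws cs) (cycleThrough σ w₀) ≡ map (assign ws cs′) (cycleThrough σ w₀)
      labels≡ = trans (sym (labels-arcsAlong σ cs)) (trans (cong (map lab) e) (labels-arcsAlong σ cs′))

    cyclesAlong-disjoint : ∀ {σ σ′ l} → σ ∈ Cyc W → σ′ ∈ Cyc W →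
                           l ∈ cyclesAlong σ → l ∈ cyclesAlong σ′ → σ ≡ σ′
    cyclesAlong-disjoint {σ} {σ′} σ∈ σ′∈ l∈ l∈′
      with ∈-map⁻ (arcsAlong σ) l∈ | ∈-map⁻ (arcsAlong σ′) l∈′
    ... | cs , _ , e | cs′ , _ , e′ =
      allMaps-≗⇒≡ (proj₁ (∈-filter⁻ (T? ∘ isCyc W) {xs = allMaps n} σ∈))
                  (proj₁ (∈-filter⁻ (T? ∘ isCyc W) {xs = allMaps n} σ′∈)) agree
      where
      cyc : IsCyclicOn W σ
      cyc = ∈-Cyc⇒IsCyclicOn σ∈
      arcs≡ : arcsAlong σ cs ≡ arcsAlong σ′ cs′
      arcs≡ = trans (sym e) e′
      cycle≡ : cycleThrough σ w₀ ≡ cycleThrough σ′ w₀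
      cycle≡ = trans (sym (vertices-arcsAlong σ cs)) (trans (cong vertices arcs≡) (vertices-arcsAlong σ′ cs′))
      targets≡ : map σ (cycleThrough σ w₀) ≡ map σ′ (cycleThrough σ w₀)
      targets≡ = trans (sym (targets-arcsAlong σ cs)) (trans (cong (map tgt) arcs≡)
                   (trans (targets-arcsAlong σ′ cs′) (cong (map σ′) (sym cycle≡))))
      agree : σ ≗ σ′
      agree v with W v in Wv
      ... | true  = map-≡⇒≡-on targets≡ (∈-cycleThrough⁺ cyc Ww₀ (subst T (sym Wv) tt))
      ... | false = trans (IsCyclicOn.fixes cyc Wv) (sym (IsCyclicOn.fixes (∈-Cyc⇒IsCyclicOn σ′∈) Wv))

    cycles-unique : Unique cycles
    cycles-unique = Unique-concatMap⁺ cyclesAlong (Unique.filter⁺ (T? ∘ isCyc W) (allMaps-unique n))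
      (λ {σ} σ∈ → Unique-map⁺-local (arcsAlong σ) (arcsAlong-injective σ∈) (choices-unique (bounds σ)))
      cyclesAlong-disjoint

    module Completeness {j t l} (simple : IsSimpleCycle m ((w₀ , j , t) ∷ l))
                        (vertexSet≗W : vertexSet ((w₀ , j , t) ∷ l) ≗ W) where

      private
        cycle : List (Arc n)
        cycle = (w₀ , j , t) ∷ l

        rest : List (Fin n)
        rest = vertices l

        distinct : Unique (vertices cycle)
        distinct = proj₂ (proj₂ (proj₂ simple))

        σ : Fin n → Fin n
        σ = successorMap cycle

      ∈-cycle⁻ : ∀ {v} → v ∈ vertices cycle → T (W v)
      ∈-cycle⁻ {v} v∈ = subst T (vertexSet≗W v) (vertexSet⁺ {l = cycle} v∈)

      ∈-cycle⁺ : ∀ {v} → T (W v) → v ∈ vertices cycle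
      ∈-cycle⁺ {v} Wv = vertexSet⁻ {l = cycle} (subst T (sym (vertexSet≗W v)) Wv)

      walk : Walk σ w₀ rest w₀
      walk = begin
        map σ (vertices cycle)   ≡⟨ sym (map-∘ cycle) ⟩
        map (σ ∘ src) cycle      ≡⟨ map-cong-local (All.tabulate (successorMap-∈ distinct)) ⟩
        map tgt cycle            ≡⟨ proj₁ (proj₂ (proj₂ simple)) ⟩
        rest ++ [ w₀ ]           ∎
        where open ≡-Reasoning

      successor-cyclic : IsCyclicOn W σ
      successor-cyclic = record { into = into ; fixes = fixes ; reaches = reaches }
        where
        into : ∀ {v} → T (W v) → T (W (σ v))
        into {v} Wv with ∈-++⁻ rest (subst (σ v ∈_) walk (∈-map⁺ σ (∈-cycle⁺ Wv)))
        ... | inj₁ σv∈ = ∈-cycle⁻ (there σv∈)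
        ... | inj₂ (here σv≡w₀) = ∈-cycle⁻ (here σv≡w₀)

        fixes : ∀ {v} → W v ≡ false → σ v ≡ v
        fixes Wv≡false = successorMap-∉ (λ v∈ → subst T Wv≡false (∈-cycle⁻ v∈))

        reaches : ∀ {w v} → T (W w) → T (W v) → ∃ λ t → t < n × iter σ t w ≡ v
        reaches {w} {v} Ww Wv with walk⇒orbit σ rest walk
        ... | cycle≡orbit , closed with orbit-reach σ (length rest) closed
                                          (subst (w ∈_) cycle≡orbit (∈-cycle⁺ Ww))
                                          (subst (v ∈_) cycle≡orbit (∈-cycle⁺ Wv))
        ...   | t , t< , hit = t , ≤-trans t< (Unique⇒length≤ distinct) , hit

      cycleThrough-successor : cycleThrough σ w₀ ≡ vertices cycle
      cycleThrough-successor = cong (w₀ ∷_) (walk-unique σ _ rest (cycleThrough-walk successor-cyclic Ww₀) walk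
        (Unique.Unique[x∷xs]⇒x∉xs (cycleThrough-unique successor-cyclic Ww₀))
        (Unique.Unique[x∷xs]⇒x∉xs distinct))

      labels : List ℕ
      labels = map (labelMap cycle) ws

      labels-bounded : labels ∈ choices (bounds σ)
      labels-bounded = ∈-choices⁺ (Pointwise-map⁺ (labelMap cycle) (λ v → m v (σ v)) bounded)
        where
        bounded : ∀ {u} → u ∈ ws → labelMap cycle u < m u (σ u)
        bounded u∈ with ∈-map⁻ src (∈-cycle⁺ (∈-ws⁻ u∈))
        ... | a , a∈ , refl =
          subst₂ _<_ (sym (labelMap-∈ distinct a∈)) (cong (m (src a)) (sym (successorMap-∈ distinct a∈)))
                 (All.lookup (proj₁ (proj₂ simple)) a∈)

      arcsAlong-successor : arcsAlong σ labels ≡ cycle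
      arcsAlong-successor = begin
        map arc (cycleThrough σ w₀)     ≡⟨ cong (map arc) cycleThrough-successor ⟩
        map arc (vertices cycle)        ≡⟨ sym (map-∘ cycle) ⟩
        map (arc ∘ src) cycle           ≡⟨ map-cong-local (All.tabulate arc-src) ⟩
        map id cycle                    ≡⟨ map-id cycle ⟩
        cycle                           ∎
        where
        open ≡-Reasoning
        arc : Fin n → Arc n
        arc u = u , σ u , assign ws labels u
        arc-src : ∀ {a} → a ∈ cycle → arc (src a) ≡ a
        arc-src {a} a∈ = cong₂ (λ j t → src a , j , t) (successorMap-∈ distinct a∈)
          (trans (assign-map (labelMap cycle) (∈-ws⁺ (∈-cycle⁻ (∈-map⁺ src a∈)))) (labelMap-∈ distinct a∈))

      cycle-∈ : cycle ∈ cycles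
      cycle-∈ = ∈-concatMap⁺ cyclesAlong {xs = Cyc W}
        (lose (∈-filter⁺ (T? ∘ isCyc W) {xs = allMaps n} (∈-allMaps _) (IsCyclicOn⇒isCyc successor-cyclic))
              (subst (_∈ cyclesAlong σ) arcsAlong-successor (∈-map⁺ (arcsAlong σ) labels-bounded)))

    cycles-complete : ∀ {l} → IsSimpleCycle m l → vertexSet l ≗ W → StartsAt w₀ l → l ∈ cycles
    cycles-complete simple vertexSet≗W (startsAt j t l) = Completeness.cycle-∈ simple vertexSet≗W

    cycles-transversal : CycleTransversal m W cycles
    cycles-transversal = record
      { unique     = cycles-unique
      ; simple     = cycles-simple
      ; vertexSet≗ = cycles-vertexSet
      ; separated  = separated
      ; complete   = complete
      }
      where
      separated : ∀ {l l′} → l ∈ cycles → l′ ∈ cycles → Rotation l l′ → l ≡ l′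
      separated l∈ l′∈ rot with cycles-startsAt l∈ | cycles-startsAt l′∈
      ... | startsAt _ _ _ | startsAt _ _ _ =
        rotation-≡-by-head src (proj₂ (proj₂ (proj₂ (cycles-simple l∈)))) refl rot

      complete : ∀ {l} → IsSimpleCycle m l → vertexSet l ≗ W → ∃ λ l′ → l′ ∈ cycles × Rotation l l′
      complete {l} simple vertexSet≗W
        with ∈-map⁻ src (vertexSet⁻ {l = l} (subst T (sym (vertexSet≗W w₀)) Ww₀))
      ... | (_ , j , t) , a∈ , refl with ∈⇒rotation a∈
      ...   | l′ , rot = _ , cycles-complete (IsSimpleCycle-resp-rotation rot simple)
                               (λ v → trans (sym (vertexSet-resp-rotation rot v)) (vertexSet≗W v))
                               (startsAt j t l′) , rot

module _ {n : ℕ} (m : Fin n → Fin n → ℕ) where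

  open CyclesThrough m

  representatives : (Fin n → Bool) → List (List (Arc n))
  representatives W = maybe′ (cycles W) [] (head (filterᵇ W (allFin n)))

  representatives-through : ∀ {W} → NonEmpty W → ∃ λ w₀ → T (W w₀) × representatives W ≡ cycles W w₀
  representatives-through {W} (v , Wv)
    with filterᵇ W (allFin n) in eq | ∈-filter⁺ (T? ∘ W) {xs = allFin n} (∈-allFin v) Wv
  ... | w₀ ∷ _ | _ = w₀ , proj₂ (∈-filter⁻ (T? ∘ W) {xs = allFin n} (subst (w₀ ∈_) (sym eq) (here refl))) , refl

  length-representatives : ∀ {W} → NonEmpty W → length (representatives W) ≡ cycSum m W
  length-representatives {W} ne with representatives-through ne
  ... | w₀ , _ , eq = trans (cong length eq) (length-cycles W w₀)

  representatives-transversal : ∀ {W} → NonEmpty W → CycleTransversal m W (representatives W)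
  representatives-transversal {W} ne with representatives-through ne
  ... | w₀ , Ww₀ , eq = subst (CycleTransversal m W) (sym eq) (cycles-transversal W w₀ Ww₀)

module _ {n k : ℕ} (κ : Fin n → Fin k → Bool) where

  K : (Fin n → Bool) → List (Fin k)
  K W = filterᵇ (λ x → all (λ v → ⌊ κ v x ≟ᵇ W v ⌋) (allFin n)) (allFin k)

  ∈-K⁺ : ∀ {W x} → (∀ v → κ v x ≡ W v) → x ∈ K W
  ∈-K⁺ {W} {x} κx≗W = ∈-filter⁺ (T? ∘ _) {xs = allFin k} (∈-allFin x) (T-all-allFin⁺ _ (fromWitness ∘ κx≗W))

  ∈-K⁻ : ∀ {W x} → x ∈ K W → ∀ v → κ v x ≡ W v
  ∈-K⁻ {W} {x} x∈ v =
    toWitness (T-all-allFin⁻ (λ v → ⌊ κ v x ≟ᵇ W v ⌋) (proj₂ (∈-filter⁻ (T? ∘ _) {xs = allFin k} x∈)) v)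

  K-unique : ∀ W → Unique (K W)
  K-unique W = Unique.filter⁺ (T? ∘ _) (Unique.allFin⁺ k)

-- From a realization to a solvable clique cover

module FromRealization {k : ℕ} (H : SimpleGraph k) {n : ℕ} {A : Fin n → Fin n → ℕ} (ρ : Realizes A H) where

  private
    f : Fin k → SimpleCycle A
    f = proj₁ ρ

    f-injective : ∀ x y → f x ≈ᶜ f y → x ≡ y
    f-injective = proj₁ (proj₂ ρ)

    f-surjective : ∀ c → ∃ λ x → f x ≈ᶜ c
    f-surjective = proj₁ (proj₂ (proj₂ ρ))

    f-adjacent : ∀ x y → x ≢ y → (Adj H x y ⇔ ShareVertex (f x) (f y))
    f-adjacent = proj₂ (proj₂ (proj₂ ρ))

  κ : Fin n → Fin k → Bool
  κ v x = vertexSet (proj₁ (f x)) v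

  κ-cliqueCover : IsCliqueCover H κ
  κ-cliqueCover = clique , covers , edges
    where
    clique : ∀ v → IsClique H (κ v)
    clique v x y κvx κvy x≢y =
      Equivalence.from (f-adjacent x y x≢y) (v , vertexSet⁻ {l = proj₁ (f x)} κvx , vertexSet⁻ {l = proj₁ (f y)} κvy)

    covers : ∀ x → ∃ λ v → T (κ v x)
    covers x with f x
    ... | []    , nonempty , _ = contradiction refl nonempty
    ... | a ∷ l , _        , _ = src a , vertexSet⁺ {l = a ∷ l} (here refl)

    edges : ∀ x y → Adj H x y → ∃ λ v → T (κ v x) × T (κ v y)
    edges x y adj with Equivalence.to (f-adjacent x y (λ { refl → irrefl H adj })) adj
    ... | v , v∈x , v∈y = v , vertexSet⁺ {l = proj₁ (f x)} v∈x , vertexSet⁺ {l = proj₁ (f y)} v∈y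

  κ-solution : Solves κ A
  κ-solution W ne = sym (trans length-K≡ (length-representatives A ne))
    where
    open CycleTransversal (representatives-transversal A ne)

    Represents : Fin k → List (Arc n) → Set
    Represents x l = l ∈ representatives A W × Rotation (proj₁ (f x)) l

    represented : ∀ {x} → x ∈ K κ W → ∃ λ l → l ∈ representatives A W × Represents x l
    represented {x} x∈ with complete (proj₂ (f x)) (∈-K⁻ κ x∈)
    ... | l , l∈ , rot = l , l∈ , l∈ , rot

    represents : ∀ {l} → l ∈ representatives A W → ∃ λ x → x ∈ K κ W × Represents x l
    represents {l} l∈ with f-surjective (l , simple l∈)
    ... | x , fx≈l = x , ∈-K⁺ κ (λ v → trans (vertexSet-resp-rotation rot v) (vertexSet≗ l∈ v)) , l∈ , rot
      where
      rot : Rotation (proj₁ (f x)) l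
      rot = ≈ᶜ⇒rotation {c = f x} {c′ = l , simple l∈} fx≈l

    length-K≡ : length (K κ W) ≡ length (representatives A W)
    length-K≡ = length-≡-by Represents (K-unique κ W) unique represented represents
      (λ {x} {x′} (_ , rot) (_ , rot′) →
        f-injective x x′ (rotation⇒≈ᶜ {c = f x} {c′ = f x′} (rotation-trans rot (rotation-sym rot′))))
      (λ (l∈ , rot) (l′∈ , rot′) → separated l∈ l′∈ (rotation-trans (rotation-sym rot) rot′))

-- From a solvable clique cover to a realization

module FromSolution {k : ℕ} (H : SimpleGraph k) {n : ℕ} (κ : Fin n → Fin k → Bool) (m : Fin n → Fin n → ℕ)
                    (cover : IsCliqueCover H κ) (solution : Solves κ m) where

  length-K≡ : ∀ {W} → NonEmpty W → length (K κ W) ≡ length (representatives m W)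
  length-K≡ {W} ne = trans (sym (solution W ne)) (sym (length-representatives m ne))

  cycleAt : ∀ {W x} → NonEmpty W → x ∈ K κ W → List (Arc n)
  cycleAt {W} ne = partner (K κ W) (representatives m W) (length-K≡ ne)

  cycleAt-∈ : ∀ {W x} (ne : NonEmpty W) (x∈ : x ∈ K κ W) → cycleAt ne x∈ ∈ representatives m W
  cycleAt-∈ {W} ne = partner-∈ (K κ W) (representatives m W) (length-K≡ ne)

  cycleAt-cong : ∀ {W W′ x} (ne : NonEmpty W) (ne′ : NonEmpty W′) (p : x ∈ K κ W) (q : x ∈ K κ W′) →
                 W ≡ W′ → cycleAt ne p ≡ cycleAt ne′ q
  cycleAt-cong {W} ne ne′ p q refl = cong (lookup (representatives m W) ∘ cast (length-K≡ ne))
                                          (index-irrelevant (K-unique κ W) p q)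

  cycleAt-separated : ∀ {W W′ x y} (ne : NonEmpty W) (ne′ : NonEmpty W′) (p : x ∈ K κ W) (q : y ∈ K κ W′) →
                      W ≡ W′ → Rotation (cycleAt ne p) (cycleAt ne′ q) → x ≡ y
  cycleAt-separated {W} ne ne′ p q refl rot =
    partner-injective (K κ W) (representatives m W) (length-K≡ ne) unique p q
                      (separated (cycleAt-∈ ne p) (cycleAt-∈ ne′ q) rot)
    where open CycleTransversal (representatives-transversal m ne)

  support : Fin k → Fin n → Bool
  support x = tabulated (λ v → κ v x)

  support≗ : ∀ x v → support x v ≡ κ v x
  support≗ x = tabulated-≗ (λ v → κ v x)

  support-nonempty : ∀ x → NonEmpty (support x)
  support-nonempty x with proj₁ (proj₂ cover) x
  ... | v , κvx = v , subst T (sym (support≗ x v)) κvx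

  ∈-K-support : ∀ x → x ∈ K κ (support x)
  ∈-K-support x = ∈-K⁺ κ (sym ∘ support≗ x)

  cycleOf : Fin k → List (Arc n)
  cycleOf x = cycleAt (support-nonempty x) (∈-K-support x)

  cycleOf-simple : ∀ x → IsSimpleCycle m (cycleOf x)
  cycleOf-simple x = CycleTransversal.simple (representatives-transversal m (support-nonempty x))
                                             (cycleAt-∈ (support-nonempty x) (∈-K-support x))

  cycleOf-vertexSet : ∀ x v → vertexSet (cycleOf x) v ≡ κ v x
  cycleOf-vertexSet x v =
    trans (CycleTransversal.vertexSet≗ (representatives-transversal m (support-nonempty x))
                                       (cycleAt-∈ (support-nonempty x) (∈-K-support x)) v)
          (support≗ x v)

  ∈-cycleOf⁺ : ∀ {v x} → T (κ v x) → v ∈ vertices (cycleOf x)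
  ∈-cycleOf⁺ {v} {x} κvx = vertexSet⁻ {l = cycleOf x} (subst T (sym (cycleOf-vertexSet x v)) κvx)

  ∈-cycleOf⁻ : ∀ {v x} → v ∈ vertices (cycleOf x) → T (κ v x)
  ∈-cycleOf⁻ {v} {x} v∈ = subst T (cycleOf-vertexSet x v) (vertexSet⁺ {l = cycleOf x} v∈)

  φ : Fin k → SimpleCycle m
  φ x = cycleOf x , cycleOf-simple x

  φ-injective : ∀ x y → φ x ≈ᶜ φ y → x ≡ y
  φ-injective x y φx≈φy = cycleAt-separated (support-nonempty x) (support-nonempty y)
                                            (∈-K-support x) (∈-K-support y) support≡ rot
    where
    rot : Rotation (cycleOf x) (cycleOf y)
    rot = ≈ᶜ⇒rotation {c = φ x} {c′ = φ y} φx≈φy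
    support≡ : support x ≡ support y
    support≡ = tabulated-cong (λ v →
      trans (sym (cycleOf-vertexSet x v)) (trans (vertexSet-resp-rotation rot v) (cycleOf-vertexSet y v)))

  cycleSupport : List (Arc n) → Fin n → Bool
  cycleSupport l = tabulated (vertexSet l)

  cycleSupport≗ : ∀ l v → cycleSupport l v ≡ vertexSet l v
  cycleSupport≗ l = tabulated-≗ (vertexSet l)

  cycleSupport-nonempty : ∀ {l} → l ≢ [] → NonEmpty (cycleSupport l)
  cycleSupport-nonempty {[]}    nonempty = contradiction refl nonempty
  cycleSupport-nonempty {a ∷ l} _        =
    src a , subst T (sym (cycleSupport≗ (a ∷ l) (src a))) (vertexSet⁺ {l = a ∷ l} (here refl))

  φ-surjective : ∀ c → ∃ λ x → φ x ≈ᶜ c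
  φ-surjective c@(l , simple) =
    let ne             = cycleSupport-nonempty (proj₁ simple)
        l′ , l′∈ , rot = CycleTransversal.complete (representatives-transversal m ne) simple (sym ∘ cycleSupport≗ l)
        x , x∈ , x↦l′  = partner-surjective (K κ _) (representatives m _) (length-K≡ ne) l′∈
        support≡       = tabulated-cong (λ v → trans (∈-K⁻ κ x∈ v) (cycleSupport≗ l v))
        φx≡l′          = trans (cycleAt-cong (support-nonempty x) ne (∈-K-support x) x∈ support≡) x↦l′
    in x , rotation⇒≈ᶜ {c = φ x} {c′ = c} (subst (λ l″ → Rotation l″ l) (sym φx≡l′) (rotation-sym rot))

  φ-adjacent : ∀ x y → x ≢ y → (Adj H x y ⇔ ShareVertex (φ x) (φ y))
  φ-adjacent x y x≢y = mk⇔ to from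
    where
    to : Adj H x y → ShareVertex (φ x) (φ y)
    to adj with proj₂ (proj₂ cover) x y adj
    ... | v , κvx , κvy = v , ∈-cycleOf⁺ κvx , ∈-cycleOf⁺ κvy

    from : ShareVertex (φ x) (φ y) → Adj H x y
    from (v , v∈x , v∈y) = proj₁ cover v x y (∈-cycleOf⁻ v∈x) (∈-cycleOf⁻ v∈y) x≢y

  realizes : Realizes m H
  realizes = φ , φ-injective , φ-surjective , φ-adjacent

realizable⇒solvable : ∀ {k} (H : SimpleGraph k) → Realizable H →
  ∃ λ n → ∃ λ (κ : Fin n → Fin k → Bool) →
    IsCliqueCover H κ × ∃ λ (m : Fin n → Fin n → ℕ) → Solves κ m
realizable⇒solvable H (n , A , ρ) = n , κ , κ-cliqueCover , A , κ-solution
  where open FromRealization H ρ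

theorem1 : ∀ {k} (H : SimpleGraph k) →
    (Realizable H →
    ∃ λ n → ∃ λ (κ : Fin n → Fin k → Bool) →
    IsCliqueCover H κ × ∃ λ (m : Fin n → Fin n → ℕ) → Solves κ m) ×
    (∀ n (κ : Fin n → Fin k → Bool) (m : Fin n → Fin n → ℕ) →
    IsCliqueCover H κ → Solves κ m → Realizes m H)
theorem1 H = realizable⇒solvable H , λ n κ m cover solution →
  FromSolution.realizes H κ m cover solution
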